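{- Let $k\ge 2$ and $\alpha\ge 1$ be integers, and let $A$ be the $k^{\alpha}\times \alpha k$ benchmark matrix defined in the context, with induced clusterings $\mathcal{C}^{0},\dots,\mathcal{C}^{\alpha-1}$. Then for all $a\neq a'$ in $\{0,\dots,\alpha-1\}$ we have $d(\mathcal{C}^{a},\mathcal{C}^{a'}) = 1-\frac{1}{k}$.
   Context: Benchmark construction. Fix integers $k\ge 2$, $\alpha\ge 1$, and put $n=k^{\alpha}$, $d=\alpha k$. Let $\mathbb{1}_m$ be the all-ones vector of length $m$, and let $\otimes$ be the Kronecker product, so that for a vector $v$ of length $m$, $v\otimes \mathbb{1}_k$ is the vector of length $mk$ obtained by replacing each entry $v_j$ by the block $v_j\mathbb{1}_k$, and $\mathbb{1}_r\otimes v$ is $v$ repeated $r$ times. For $i\in\{1,\dots,k\}$ let $v_i^1\in\mathbb{R}^k$ have entries $(v_i^1)_j=-\frac1k$ for $j\ne i$ and $(v_i^1)_i=\frac{k-1}{k}$; for $\ell\ge 2$ let $v_i^{\ell}=v_i^{\ell-1}\otimes\mathbb{1}_k\in\mathbb{R}^{k^{\ell}}$. The benchmark is the $n\times d$ matrix $A$ whose column $t=a k+b$, for $a\in\{0,\dots,\alpha-1\}$ and $b\in\{1,\dots,k\}$, equals $\mathbb{1}_{k^{\alpha-a-1}}\otimes v_b^{a+1}$. The rows $A_1,\dots,A_n$ are the input points in $\mathbb{R}^d$. For each $a\in\{0,\dots,\alpha-1\}$ define the clustering $\mathcal{C}^a=\{C_1^a,\dots,C_k^a\}$ of the rows by: $A_i\in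 C_j^a$ iff $A_{i,ak+j}>0$. Clustering distance (Meila): for two clusterings $\mathcal{C}=\{C_1,\dots,C_k\}$ and $\mathcal{C}'=\{C_1',\dots,C_k'\}$ of the $n$ points, let $M$ be the $k\times k$ confusion matrix $M_{i,j}=|C_i\cap C_j'|$ and $d(\mathcal{C},\mathcal{C}')=1-\frac1n\max_{\pi\in\Pi_k}\sum_{i=1}^k M_{i,\pi(i)}$, where $\Pi_k$ is the set of permutations of $\{1,\dots,k\}$. -}

module Defs where

open import Data.Nat using (ℕ; zero; suc; _^_; _∸_; _+_; _≤_; NonZero)
import Data.Nat.Properties
open import Data.Nat.Properties using (*-comm; ^-distribˡ-+-*; m∸n+n≡m)
open import Data.Fin using (Fin; toℕ; remQuot; combine; cast; _≟_)
open import Data.Fin.Properties using (toℕ<n)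
open import Data.Fin.Subset using (Subset; _∩_; ∣_∣)
open import Data.Fin.Permutation using (Permutation′; _⟨$⟩ʳ_)
open import Data.Vec using (tabulate)
open import Data.Integer using (+_; -[1+_])
open import Data.Rational using (ℚ; _/_; _*_; _-_; 1ℚ; 0ℚ; _<_)
open import Data.Rational.Properties using (_<?_)
open import Data.Product using (Σ; _×_; proj₁; proj₂)
open import Relation.Nullary using (does; yes; no)
open import Relation.Binary.PropositionalEquality using (_≡_; trans; sym; cong)

-- real vectors of length m, modelled with rational entries (all entries of
-- the benchmark are rational)
RVec : ℕ → Set
RVec m = Fin m → ℚ

ones : (m : ℕ) → RVec m
ones m _ = 1ℚ

-- Kronecker product of vectors: (u ⊗ w)_{x p + y} = u_x w_y (0-based indices)
_⊗_ : ∀ {m p} → RVec m → RVec p → RVec (m Data.Nat.* p)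
_⊗_ {m} {p} u w i = u (proj₁ (remQuot {m} p i)) * w (proj₂ (remQuot {m} p i))

module Benchmark (k α : ℕ) .{{_ : NonZero k}} where

  -- v_i^1 (index i is 0-based here, i.e. i stands for the paper's i+1)
  v¹ : Fin k → RVec k
  v¹ i j with i ≟ j
  ... | yes _ = (+ (k ∸ 1)) / k
  ... | no  _ = -[1+ 0 ] / k

  -- v ℓ i = v_i^{ℓ+1} ∈ ℝ^{k^{ℓ+1}};  v_i^{ℓ} = v_i^{ℓ-1} ⊗ 𝟙_k
  v : (ℓ : ℕ) → Fin k → RVec (k ^ suc ℓ)
  v zero    i j = v¹ i (cast (Data.Nat.Properties.*-identityʳ k) j)
  v (suc ℓ) i j = (v ℓ i ⊗ ones k) (cast (*-comm k (k ^ suc ℓ)) j)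

  n : ℕ
  n = k ^ α

  d : ℕ
  d = α Data.Nat.* k

  len-eq : (a : Fin α) → k ^ (α ∸ suc (toℕ a)) Data.Nat.* k ^ suc (toℕ a) ≡ n
  len-eq a = trans (sym (^-distribˡ-+-* k (α ∸ suc (toℕ a)) (suc (toℕ a))))
                   (cong (k ^_) (m∸n+n≡m (toℕ<n a)))

  -- column a k + b (paper's b = this b + 1):  𝟙_{k^{α-a-1}} ⊗ v_b^{a+1}
  column : Fin α → Fin k → RVec n
  column a b i = (ones (k ^ (α ∸ suc (toℕ a))) ⊗ v (toℕ a) b) (cast (sym (len-eq a)) i)

  A : Fin n → Fin d → ℚ
  A i t = column (proj₁ (remQuot {α} k t)) (proj₂ (remQuot {α} k t)) i

  𝒞 : Fin α → Fin k → Subset n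
  𝒞 a j = tabulate λ i → does (0ℚ <? A i (combine a j))

Clustering : ℕ → ℕ → Set
Clustering n k = Fin k → Subset n

confusion : ∀ {n k} → Clustering n k → Clustering n k → Fin k → Fin k → ℕ
confusion C C' i j = ∣ C i ∩ C' j ∣

sumFin : (k : ℕ) → (Fin k → ℕ) → ℕ
sumFin zero    f = 0
sumFin (suc k) f = f Data.Fin.zero + sumFin k (λ i → f (Data.Fin.suc i))

agreement : ∀ {n k} → Clustering n k → Clustering n k → Permutation′ k → ℕ
agreement {k = k} C C' π = sumFin k (λ i → confusion C C' i (π ⟨$⟩ʳ i))

-- Meila distance: d(C,C') = r  iff  r = 1 - (1/n) max_π Σ_i M_{i,π(i)}
-- (the max is expressed by a maximising permutation)
DistIs : ∀ {n k} .{{_ : NonZero n}} → Clustering n k → Clustering n k → ℚ → Set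
DistIs {n} {k} C C' r =
  Σ (Permutation′ k) λ π →
    (∀ π′ → agreement C C' π′ ≤ agreement C C' π) ×
    (r ≡ 1ℚ - (+ agreement C C' π) / n)

{-# OPTIONS --safe #-}
module Submission where

-- Number the rows 0 ≤ x < kᵅ. Row x has a positive entry in column a k + b exactly when the
-- a-th base-k digit of x is b, so 𝒞ᵃ groups the points by their a-th digit. For a ≠ a′ every
-- pair of values of the two digits is taken by exactly kᵅ⁻² points, so the confusion matrix
-- of 𝒞ᵃ and 𝒞ᵃ′ is constant: every permutation agrees on k · kᵅ⁻² = kᵅ / k points, and
-- the distance is 1 − 1/k.

open import Defs
open import Data.Bool using (Bool; true; false; _∧_)
open import Data.Bool.Properties using (∧-comm; ∧-identityʳ)
open import Data.Empty using (⊥-elim)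
open import Data.Fin using (Fin; toℕ; combine; cast; quotient; remainder; _≟_)
import Data.Fin as Fin
open import Data.Fin.Properties using (toℕ<n; toℕ-cast; toℕ-combine; toℕ-injective; combine-remQuot; remQuot-combine)
import Data.Fin.Permutation as Permutation
open import Data.Fin.Subset using (_∩_; ∣_∣)
open import Data.Nat using (ℕ; zero; suc; _+_; _*_; _∸_; _^_; _≤_; _<_; _≡ᵇ_; NonZero; z≤n; s≤s)
open import Data.Nat.Properties
  using (+-assoc; +-comm; *-comm; *-zeroʳ; *-identityʳ; *-identityˡ; *-distribˡ-+; +-identityʳ; ≤-reflexive; n<1+n; n<1⇒n≡0; m^n≢0; m*n≢0)
import Data.Nat.Properties as ℕ
open import Data.Product using (Σ; _×_; _,_; proj₁; proj₂)
open import Data.Rational using (0ℚ; normalize; -_)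
import Data.Rational.Properties as ℚ
open import Data.Rational.Properties using (_<?_; positive⁻¹; negative⁻¹; normalize-pos; neg-pos; <-asym)
open import Data.Vec using (_∷_; tabulate)
open import Data.Vec.Properties using (tabulate-cong)
open import Function using (_∘_; const)
open import Relation.Binary.PropositionalEquality
open import Relation.Nullary using (does; yes; no)
open import Relation.Nullary.Decidable using (dec-true; dec-false)

boolToℕ : Bool → ℕ
boolToℕ false = 0
boolToℕ true  = 1

sumUpTo : ℕ → (ℕ → ℕ) → ℕ
sumUpTo zero    f = 0
sumUpTo (suc n) f = f 0 + sumUpTo n (f ∘ suc)

sumUpTo-cong : ∀ n {f g : ℕ → ℕ} → (∀ x → x < n → f x ≡ g x) → sumUpTo n f ≡ sumUpTo n g
sumUpTo-cong zero    f≡g = refl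
sumUpTo-cong (suc n) f≡g = cong₂ _+_ (f≡g 0 (s≤s z≤n)) (sumUpTo-cong n (λ x x<n → f≡g (suc x) (s≤s x<n)))

sumUpTo-+ : ∀ m n (f : ℕ → ℕ) → sumUpTo (m + n) f ≡ sumUpTo m f + sumUpTo n (λ r → f (m + r))
sumUpTo-+ zero    n f = refl
sumUpTo-+ (suc m) n f = trans (cong (f 0 +_) (sumUpTo-+ m n (f ∘ suc))) (sym (+-assoc (f 0) _ _))

sumUpTo-* : ∀ m n (f : ℕ → ℕ) → sumUpTo (m * n) f ≡ sumUpTo m (λ q → sumUpTo n (λ r → f (q * n + r)))
sumUpTo-* zero    n f = refl
sumUpTo-* (suc m) n f = begin
  sumUpTo (n + m * n) f                                          ≡⟨ sumUpTo-+ n (m * n) f ⟩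
  sumUpTo n f + sumUpTo (m * n) (λ r → f (n + r))                 ≡⟨ cong (sumUpTo n f +_) (sumUpTo-* m n _) ⟩
  sumUpTo n f + sumUpTo m (λ q → sumUpTo n (λ r → f (n + (q * n + r))))
    ≡⟨ cong (sumUpTo n f +_) (sumUpTo-cong m (λ q _ → sumUpTo-cong n (λ r _ → cong f (sym (+-assoc n (q * n) r))))) ⟩
  sumUpTo n f + sumUpTo m (λ q → sumUpTo n (λ r → f (suc q * n + r))) ∎
  where open ≡-Reasoning

sumUpTo-const : ∀ n c → sumUpTo n (const c) ≡ n * c
sumUpTo-const zero    c = refl
sumUpTo-const (suc n) c = cong (c +_) (sumUpTo-const n c)

sumUpTo-*ˡ : ∀ n c (f : ℕ → ℕ) → sumUpTo n (λ x → c * f x) ≡ c * sumUpTo n f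
sumUpTo-*ˡ zero    c f = sym (*-zeroʳ c)
sumUpTo-*ˡ (suc n) c f = trans (cong (c * f 0 +_) (sumUpTo-*ˡ n c (f ∘ suc))) (sym (*-distribˡ-+ c (f 0) _))

sumUpTo-≡ᵇ-∧ : ∀ {n j} b → j < n → sumUpTo n (λ r → boolToℕ ((r ≡ᵇ j) ∧ b)) ≡ boolToℕ b
sumUpTo-≡ᵇ-∧ {suc n} {zero}  b _ =
  trans (cong (boolToℕ b +_) (trans (sumUpTo-const n 0) (*-zeroʳ n))) (+-identityʳ (boolToℕ b))
sumUpTo-≡ᵇ-∧ {suc n} {suc j} b (s≤s j<n) = sumUpTo-≡ᵇ-∧ b j<n

sumUpTo-≡ᵇ : ∀ {n j} → j < n → sumUpTo n (λ r → boolToℕ (r ≡ᵇ j)) ≡ 1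
sumUpTo-≡ᵇ {n} {j} j<n =
  trans (sumUpTo-cong n (λ r _ → cong boolToℕ (sym (∧-identityʳ (r ≡ᵇ j))))) (sumUpTo-≡ᵇ-∧ true j<n)

sumFin≡sumUpTo : ∀ n {f : Fin n → ℕ} {g : ℕ → ℕ} → (∀ i → f i ≡ g (toℕ i)) → sumFin n f ≡ sumUpTo n g
sumFin≡sumUpTo zero    f≡g = refl
sumFin≡sumUpTo (suc n) f≡g = cong₂ _+_ (f≡g Fin.zero) (sumFin≡sumUpTo n (f≡g ∘ Fin.suc))

∣tabulate∣ : ∀ n (p : Fin n → Bool) → ∣ tabulate p ∣ ≡ sumFin n (boolToℕ ∘ p)
∣tabulate∣ zero    p = refl
∣tabulate∣ (suc n) p with p Fin.zero
... | true  = cong suc (∣tabulate∣ n (p ∘ Fin.suc))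
... | false = ∣tabulate∣ n (p ∘ Fin.suc)

tabulate-∩ : ∀ {n} (p q : Fin n → Bool) → tabulate p ∩ tabulate q ≡ tabulate (λ i → p i ∧ q i)
tabulate-∩ {zero}  p q = refl
tabulate-∩ {suc n} p q = cong (p Fin.zero ∧ q Fin.zero ∷_) (tabulate-∩ (p ∘ Fin.suc) (q ∘ Fin.suc))

-- ℕ division is opened only inside modules, so that Data.Rational's _/_ is unambiguous in fact1.
module _ where
  open import Data.Nat.DivMod using (_/_; _%_; m*n/n≡m; m<n⇒m%n≡m; [m+kn]%n≡m%n; +-distrib-/-∣ˡ; m<n⇒m/n≡0)
  open import Data.Nat.Divisibility using (n∣m*n)

  [m*n+r]%n≡r : ∀ m {n r} .{{_ : NonZero n}} → r < n → (m * n + r) % n ≡ r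
  [m*n+r]%n≡r m {n} {r} r<n = trans (cong (_% n) (+-comm (m * n) r)) (trans ([m+kn]%n≡m%n r m n) (m<n⇒m%n≡m r<n))

  [m*n+r]/n≡m : ∀ m {n r} .{{_ : NonZero n}} → r < n → (m * n + r) / n ≡ m
  [m*n+r]/n≡m m {n} {r} r<n = begin
    (m * n + r) / n   ≡⟨ +-distrib-/-∣ˡ r (n∣m*n m) ⟩
    m * n / n + r / n ≡⟨ cong₂ _+_ (m*n/n≡m m n) (m<n⇒m/n≡0 r<n) ⟩
    m + 0             ≡⟨ +-identityʳ m ⟩
    m                 ∎
    where open ≡-Reasoning

  toℕ-remQuot : ∀ m n (i : Fin (m * n)) → toℕ i ≡ toℕ (quotient {m} n i) * n + toℕ (remainder {m} n i)
  toℕ-remQuot m n i = begin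
    toℕ i                                                  ≡⟨ cong toℕ (combine-remQuot {m} n i) ⟨
    toℕ (combine (quotient {m} n i) (remainder {m} n i))   ≡⟨ toℕ-combine (quotient {m} n i) (remainder {m} n i) ⟩
    n * toℕ (quotient {m} n i) + toℕ (remainder {m} n i)   ≡⟨ cong (_+ toℕ (remainder {m} n i)) (*-comm n _) ⟩
    toℕ (quotient {m} n i) * n + toℕ (remainder {m} n i)   ∎
    where open ≡-Reasoning

  toℕ-quotient : ∀ m n .{{_ : NonZero n}} (i : Fin (m * n)) → toℕ (quotient {m} n i) ≡ toℕ i / n
  toℕ-quotient m n i = sym (trans (cong (_/ n) (toℕ-remQuot m n i)) ([m*n+r]/n≡m _ (toℕ<n (remainder {m} n i))))

  toℕ-remainder : ∀ m n .{{_ : NonZero n}} (i : Fin (m * n)) → toℕ (remainder {m} n i) ≡ toℕ i % n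
  toℕ-remainder m n i = sym (trans (cong (_% n) (toℕ-remQuot m n i)) ([m*n+r]%n≡r (toℕ (quotient {m} n i)) (toℕ<n (remainder {m} n i))))

module Digits (k : ℕ) .{{_ : NonZero k}} where
  open import Data.Nat.DivMod using (_/_; _%_; %-congʳ; m∣n⇒o%n%m≡o%m; m%[n*o]/o≡m/o%n)
  open import Data.Nat.Divisibility using (m∣m*n)

  digit : ℕ → ℕ → ℕ
  digit zero    x = x % k
  digit (suc a) x = digit a (x / k)

  digit-%-^ : ∀ a b x → a < b → digit a ((x % k ^ b) {{m^n≢0 k b}}) ≡ digit a x
  digit-%-^ zero    (suc b) x _ =
    m∣n⇒o%n%m≡o%m k (k ^ suc b) x {{_}} {{m^n≢0 k (suc b)}} (m∣m*n (k ^ b))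
  digit-%-^ (suc a) (suc b) x (s≤s a<b) = begin
    digit a (x % (k * k ^ b) / k) ≡⟨ cong (λ y → digit a (y / k)) (%-congʳ (*-comm k (k ^ b))) ⟩
    digit a (x % (k ^ b * k) / k) ≡⟨ cong (digit a) (m%[n*o]/o≡m/o%n x (k ^ b) k) ⟩
    digit a (x / k % k ^ b)       ≡⟨ digit-%-^ a b (x / k) a<b ⟩
    digit a (x / k)               ∎
    where
    open ≡-Reasoning
    instance
      k^b≢0 : NonZero (k ^ b)
      k^b≢0 = m^n≢0 k b
      k*k^b≢0 : NonZero (k * k ^ b)
      k*k^b≢0 = m^n≢0 k (suc b)
      k^b*k≢0 : NonZero (k ^ b * k)
      k^b*k≢0 = m*n≢0 (k ^ b) k

  sumUpTo-k^suc : ∀ M (h : ℕ → ℕ → ℕ) →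
                  sumUpTo (k ^ suc M) (λ x → h (x % k) (x / k)) ≡ sumUpTo (k ^ M) (λ q → sumUpTo k (λ r → h r q))
  sumUpTo-k^suc M h = begin
    sumUpTo (k * k ^ M) (λ x → h (x % k) (x / k))
      ≡⟨ cong (λ n → sumUpTo n (λ x → h (x % k) (x / k))) (*-comm k (k ^ M)) ⟩
    sumUpTo (k ^ M * k) (λ x → h (x % k) (x / k))
      ≡⟨ sumUpTo-* (k ^ M) k _ ⟩
    sumUpTo (k ^ M) (λ q → sumUpTo k (λ r → h ((q * k + r) % k) ((q * k + r) / k)))
      ≡⟨ sumUpTo-cong (k ^ M) (λ q _ → sumUpTo-cong k (λ r r<k → cong₂ h ([m*n+r]%n≡r q r<k) ([m*n+r]/n≡m q r<k))) ⟩
    sumUpTo (k ^ M) (λ q → sumUpTo k (λ r → h r q)) ∎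
    where open ≡-Reasoning

  sumUpTo-k^suc-/ : ∀ M (h : ℕ → ℕ) → sumUpTo (k ^ suc M) (λ x → h (x / k)) ≡ k * sumUpTo (k ^ M) h
  sumUpTo-k^suc-/ M h = begin
    sumUpTo (k ^ suc M) (λ x → h (x / k))           ≡⟨ sumUpTo-k^suc M (λ _ q → h q) ⟩
    sumUpTo (k ^ M) (λ q → sumUpTo k (const (h q))) ≡⟨ sumUpTo-cong (k ^ M) (λ q _ → sumUpTo-const k (h q)) ⟩
    sumUpTo (k ^ M) (λ q → k * h q)                 ≡⟨ sumUpTo-*ˡ (k ^ M) k h ⟩
    k * sumUpTo (k ^ M) h                           ∎
    where open ≡-Reasoning

  count-digit : ∀ M a {j} → a < suc M → j < k → sumUpTo (k ^ suc M) (λ x → boolToℕ (digit a x ≡ᵇ j)) ≡ k ^ M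
  count-digit M zero {j} _ j<k = begin
    sumUpTo (k ^ suc M) (λ x → boolToℕ (x % k ≡ᵇ j))           ≡⟨ sumUpTo-k^suc M (λ r _ → boolToℕ (r ≡ᵇ j)) ⟩
    sumUpTo (k ^ M) (λ q → sumUpTo k (λ r → boolToℕ (r ≡ᵇ j))) ≡⟨ sumUpTo-cong (k ^ M) (λ _ _ → sumUpTo-≡ᵇ j<k) ⟩
    sumUpTo (k ^ M) (const 1)                                  ≡⟨ sumUpTo-const (k ^ M) 1 ⟩
    k ^ M * 1                                                  ≡⟨ *-identityʳ (k ^ M) ⟩
    k ^ M                                                      ∎
    where open ≡-Reasoning
  count-digit (suc M) (suc a) (s≤s a<1+M) j<k =
    trans (sumUpTo-k^suc-/ (suc M) _) (cong (k *_) (count-digit M a a<1+M j<k))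

  count-digit-zero-pair : ∀ M b {j j′} → b < suc M → j < k → j′ < k →
                          sumUpTo (k ^ suc (suc M)) (λ x → boolToℕ ((digit zero x ≡ᵇ j) ∧ (digit (suc b) x ≡ᵇ j′))) ≡ k ^ M
  count-digit-zero-pair M b {j} {j′} b<1+M j<k j′<k = begin
    sumUpTo (k ^ suc (suc M)) (λ x → boolToℕ ((x % k ≡ᵇ j) ∧ (digit b (x / k) ≡ᵇ j′)))
      ≡⟨ sumUpTo-k^suc (suc M) (λ r q → boolToℕ ((r ≡ᵇ j) ∧ (digit b q ≡ᵇ j′))) ⟩
    sumUpTo (k ^ suc M) (λ q → sumUpTo k (λ r → boolToℕ ((r ≡ᵇ j) ∧ (digit b q ≡ᵇ j′))))
      ≡⟨ sumUpTo-cong (k ^ suc M) (λ q _ → sumUpTo-≡ᵇ-∧ (digit b q ≡ᵇ j′) j<k) ⟩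
    sumUpTo (k ^ suc M) (λ q → boolToℕ (digit b q ≡ᵇ j′))
      ≡⟨ count-digit M b b<1+M j′<k ⟩
    k ^ M ∎
    where open ≡-Reasoning

  count-digit-pair : ∀ M a a′ {j j′} → a ≢ a′ → a < suc (suc M) → a′ < suc (suc M) → j < k → j′ < k →
                     sumUpTo (k ^ suc (suc M)) (λ x → boolToℕ ((digit a x ≡ᵇ j) ∧ (digit a′ x ≡ᵇ j′))) ≡ k ^ M
  count-digit-pair M zero zero a≢a′ _ _ _ _ = ⊥-elim (a≢a′ refl)
  count-digit-pair M zero (suc b′) _ _ (s≤s b′<1+M) j<k j′<k = count-digit-zero-pair M b′ b′<1+M j<k j′<k
  count-digit-pair M (suc b) zero {j} {j′} _ (s≤s b<1+M) _ j<k j′<k =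
    trans (sumUpTo-cong (k ^ suc (suc M)) (λ x _ → cong boolToℕ (∧-comm (digit (suc b) x ≡ᵇ j) (x % k ≡ᵇ j′))))
          (count-digit-zero-pair M b b<1+M j′<k j<k)
  count-digit-pair (suc M) (suc b) (suc b′) a≢a′ (s≤s b<2+M) (s≤s b′<2+M) j<k j′<k =
    trans (sumUpTo-k^suc-/ (suc (suc M)) _) (cong (k *_) (count-digit-pair M b b′ (a≢a′ ∘ cong suc) b<2+M b′<2+M j<k j′<k))
  count-digit-pair zero (suc b) (suc b′) a≢a′ (s≤s b<1) (s≤s b′<1) _ _ =
    ⊥-elim (a≢a′ (cong suc (trans (n<1⇒n≡0 b<1) (sym (n<1⇒n≡0 b′<1)))))

module BenchmarkDigits (k′ α : ℕ) where
  open import Data.Nat.DivMod using (_/_; _%_; m<n⇒m%n≡m)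

  k : ℕ
  k = suc (suc k′)

  open Benchmark k α
  open Digits k

  v¹-positive : ∀ i j → does (0ℚ <? v¹ i j) ≡ (toℕ j ≡ᵇ toℕ i)
  -- does (m ℕ.≟ n) computes to m ≡ᵇ n.
  v¹-positive i j with i ≟ j
  ... | yes i≡j = trans (dec-true (0ℚ <? normalize (suc k′) k) (positive⁻¹ _ {{normalize-pos (suc k′) k}}))
                        (sym (dec-true (toℕ j ℕ.≟ toℕ i) (cong toℕ (sym i≡j))))
  ... | no  i≢j = trans (dec-false (0ℚ <? - normalize 1 k) (<-asym (negative⁻¹ (- normalize 1 k) {{neg-pos {normalize 1 k} (normalize-pos 1 k)}})))
                        (sym (dec-false (toℕ j ℕ.≟ toℕ i) (i≢j ∘ sym ∘ toℕ-injective)))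

  v-entry : ∀ ℓ i (r : Fin (k ^ suc ℓ)) → Σ (Fin k) λ q → toℕ q ≡ digit ℓ (toℕ r) × v ℓ i r ≡ v¹ i q
  v-entry zero    i r = cast _ r , trans (toℕ-cast _ r) (sym (m<n⇒m%n≡m (subst (toℕ r <_) (*-identityʳ k) (toℕ<n r)))) , refl
  v-entry (suc ℓ) i r with v-entry ℓ i (quotient {k ^ suc ℓ} k (cast (*-comm k (k ^ suc ℓ)) r))
  ... | q , toℕq≡ , vℓ≡ = q , trans toℕq≡ (cong (digit ℓ) toℕ-quotient-cast) , trans (ℚ.*-identityʳ _) vℓ≡
    where
    toℕ-quotient-cast : toℕ (quotient {k ^ suc ℓ} k (cast (*-comm k (k ^ suc ℓ)) r)) ≡ toℕ r / k
    toℕ-quotient-cast = trans (toℕ-quotient (k ^ suc ℓ) k _) (cong (_/ k) (toℕ-cast _ r))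

  A-positive : ∀ x a j → does (0ℚ <? A x (combine a j)) ≡ (digit (toℕ a) (toℕ x) ≡ᵇ toℕ j)
  A-positive x a j = begin
    does (0ℚ <? A x (combine a j))   ≡⟨ cong (λ (b , c) → does (0ℚ <? column b c x)) (remQuot-combine a j) ⟩
    does (0ℚ <? column a j x)        ≡⟨ cong (λ y → does (0ℚ <? y)) (trans (ℚ.*-identityˡ _) v≡v¹) ⟩
    does (0ℚ <? v¹ j q)              ≡⟨ v¹-positive j q ⟩
    (toℕ q ≡ᵇ toℕ j)                 ≡⟨ cong (_≡ᵇ toℕ j) (trans toℕq≡ digit-R) ⟩
    (digit (toℕ a) (toℕ x) ≡ᵇ toℕ j) ∎
    where
    open ≡-Reasoning
    instance
      k^1+a≢0 : NonZero (k ^ suc (toℕ a))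
      k^1+a≢0 = m^n≢0 k (suc (toℕ a))
    x′ : Fin (k ^ (α ∸ suc (toℕ a)) * k ^ suc (toℕ a))
    x′ = cast (sym (len-eq a)) x
    R : Fin (k ^ suc (toℕ a))
    R = remainder {k ^ (α ∸ suc (toℕ a))} (k ^ suc (toℕ a)) x′
    q : Fin k
    q = proj₁ (v-entry (toℕ a) j R)
    toℕq≡ : toℕ q ≡ digit (toℕ a) (toℕ R)
    toℕq≡ = proj₁ (proj₂ (v-entry (toℕ a) j R))
    v≡v¹ : v (toℕ a) j R ≡ v¹ j q
    v≡v¹ = proj₂ (proj₂ (v-entry (toℕ a) j R))
    digit-R : digit (toℕ a) (toℕ R) ≡ digit (toℕ a) (toℕ x)
    digit-R = begin
      digit (toℕ a) (toℕ R)                    ≡⟨ cong (digit (toℕ a)) (toℕ-remainder (k ^ (α ∸ suc (toℕ a))) (k ^ suc (toℕ a)) x′) ⟩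
      digit (toℕ a) (toℕ x′ % k ^ suc (toℕ a)) ≡⟨ cong (λ y → digit (toℕ a) (y % k ^ suc (toℕ a))) (toℕ-cast _ x) ⟩
      digit (toℕ a) (toℕ x % k ^ suc (toℕ a))  ≡⟨ digit-%-^ (toℕ a) (suc (toℕ a)) (toℕ x) (n<1+n (toℕ a)) ⟩
      digit (toℕ a) (toℕ x)                    ∎

  𝒞-digit : ∀ a j → 𝒞 a j ≡ tabulate (λ x → digit (toℕ a) (toℕ x) ≡ᵇ toℕ j)
  𝒞-digit a j = tabulate-cong (λ x → A-positive x a j)

confusion-𝒞 : ∀ k′ M (a a′ : Fin (suc (suc M))) → a ≢ a′ → ∀ i j →
              let open Benchmark (suc (suc k′)) (suc (suc M)) in
              confusion (𝒞 a) (𝒞 a′) i j ≡ suc (suc k′) ^ M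
confusion-𝒞 k′ M a a′ a≢a′ i j = begin
  ∣ 𝒞 a i ∩ 𝒞 a′ j ∣                          ≡⟨ cong₂ (λ C C′ → ∣ C ∩ C′ ∣) (𝒞-digit a i) (𝒞-digit a′ j) ⟩
  ∣ tabulate p ∩ tabulate q ∣                  ≡⟨ cong ∣_∣ (tabulate-∩ p q) ⟩
  ∣ tabulate (λ x → p x ∧ q x) ∣               ≡⟨ ∣tabulate∣ n (λ x → p x ∧ q x) ⟩
  sumFin n (λ x → boolToℕ (p x ∧ q x))        ≡⟨ sumFin≡sumUpTo n (λ _ → refl) ⟩
  sumUpTo n (λ x → boolToℕ ((digit (toℕ a) x ≡ᵇ toℕ i) ∧ (digit (toℕ a′) x ≡ᵇ toℕ j)))
    ≡⟨ count-digit-pair M (toℕ a) (toℕ a′) (a≢a′ ∘ toℕ-injective) (toℕ<n a) (toℕ<n a′) (toℕ<n i) (toℕ<n j) ⟩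
  k ^ M                                        ∎
  where
  open ≡-Reasoning
  open BenchmarkDigits k′ (suc (suc M))
  open Benchmark k (suc (suc M))
  open Digits k
  p q : Fin n → Bool
  p x = digit (toℕ a) (toℕ x) ≡ᵇ toℕ i
  q x = digit (toℕ a′) (toℕ x) ≡ᵇ toℕ j

open import Data.Integer using (+_)
import Data.Integer.Properties as ℤ
open import Data.Rational using (_/_; _-_; 1ℚ)
open import Data.Rational.Properties using (fromℚᵘ-cong)
open import Data.Rational.Unnormalised using (mkℚᵘ; *≡*)

/-cong-cross : ∀ a b c d .{{_ : NonZero b}} .{{_ : NonZero d}} → a * d ≡ c * b → (+ a) / b ≡ (+ c) / d
/-cong-cross a (suc b) c (suc d) ad≡cb = fromℚᵘ-cong {mkℚᵘ (+ a) b} {mkℚᵘ (+ c) d}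
  (*≡* (trans (sym (ℤ.pos-* a (suc d))) (trans (cong +_ ad≡cb) (ℤ.pos-* c (suc b)))))

constant-confusion⇒DistIs : ∀ {n k} .{{_ : NonZero n}} (C C′ : Clustering n k) c →
                            (∀ i j → confusion C C′ i j ≡ c) → DistIs C C′ (1ℚ - (+ (k * c)) / n)
constant-confusion⇒DistIs {n} {k} C C′ c confusion≡c =
  Permutation.id ,
  (λ π → ≤-reflexive (trans (agreement≡ π) (sym (agreement≡ Permutation.id)))) ,
  cong (λ m → 1ℚ - (+ m) / n) (sym (agreement≡ Permutation.id))
  where
  agreement≡ : ∀ π → agreement C C′ π ≡ k * c
  agreement≡ π = trans (sumFin≡sumUpTo k {g = const c} (λ i → confusion≡c i (π Permutation.⟨$⟩ʳ i))) (sumUpTo-const k c)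

fact1 : (k α : ℕ) .{{_ : NonZero k}} → 2 ≤ k → 1 ≤ α →
          (a a′ : Fin α) → a ≢ a′ →
          DistIs {{m^n≢0 k α}} (Benchmark.𝒞 k α a) (Benchmark.𝒞 k α a′) (1ℚ - (+ 1) / k)
fact1 (suc (suc k′)) (suc zero) (s≤s (s≤s _)) _ Fin.zero Fin.zero a≢a′ = ⊥-elim (a≢a′ refl)
fact1 k@(suc (suc k′)) (suc (suc M)) (s≤s (s≤s _)) _ a a′ a≢a′ =
  subst (DistIs {{m^n≢0 k (suc (suc M))}} (𝒞 a) (𝒞 a′)) (cong (λ r → 1ℚ - r) (sym 1/k≡k^[1+M]/k^[2+M]))
        (constant-confusion⇒DistIs {{m^n≢0 k (suc (suc M))}} (𝒞 a) (𝒞 a′) (k ^ M) (confusion-𝒞 k′ M a a′ a≢a′))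
  where
  open Benchmark k (suc (suc M))
  1/k≡k^[1+M]/k^[2+M] : (+ 1) / k ≡ ((+ (k * k ^ M)) / k ^ suc (suc M)) {{m^n≢0 k (suc (suc M))}}
  1/k≡k^[1+M]/k^[2+M] = /-cong-cross 1 k (k * k ^ M) (k ^ suc (suc M)) {{_}} {{m^n≢0 k (suc (suc M))}}
                          (trans (*-identityˡ _) (*-comm k (k * k ^ M)))
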